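{- Let $f \in \mathbb{Z}[X]$ be a monic quadratic polynomial with roots $\alpha,\beta$ such that $\alpha\beta = -1$ and $\alpha/\beta$ is not a root of unity, and let $g \in \mathbb{Z}[X]$ be a monic polynomial with $f \mid g$. Then $m \in \mathfrak{M}(g)$ for every integer $m \ge 7$ with $m \ne 10$ and $4 \nmid m$.
   Context: For a nonconstant monic polynomial $g(X) = X^r - c_1X^{r-1} - \cdots - c_r \in \mathbb{Z}[X]$, an integer linear recurrence with characteristic polynomial $g$ is an integer sequence $(s_n)_{n\ge 0}$ with $s_n = c_1 s_{n-1} + \cdots + c_r s_{n-r}$ for all $n \ge r$ (arbitrary integer initial conditions $s_0,\dots,s_{r-1}$). $\mathfrak{M}(g)$ is the set of positive integers $m$ for which there exist integer initial conditions and a positive integer $M$ such that the resulting recurrence takes exactly $m$ distinct residues modulo $M$. -}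

module Defs where

open import Data.Nat as ℕ using (ℕ; zero; suc; _∸_; _≥_)
open import Data.Integer as ℤ using (ℤ; +_; _%ℕ_)
open import Data.Fin using (Fin; toℕ)
import Data.Fin as F
open import Data.Vec using (Vec; toList; lookup)
open import Data.List using (List; []; _∷_; reverse; map; _++_; length)
open import Data.List.Membership.Propositional using (_∈_)
open import Data.List.Relation.Unary.Unique.Propositional using (Unique)
open import Data.Product using (Σ; ∃; _×_)
open import Data.Sum using (_⊎_)
open import Function.Bundles using (_⇔_)
open import Relation.Binary.PropositionalEquality using (_≡_)

-- Polynomials in ℤ[X] as coefficient lists, constant term first.

Poly : Set
Poly = List ℤ

coeff : Poly → ℕ → ℤ
coeff []       _       = + 0
coeff (a ∷ _)  zero    = a
coeff (_ ∷ p)  (suc i) = coeff p i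

polyAdd : Poly → Poly → Poly
polyAdd []       q        = q
polyAdd p        []       = p
polyAdd (a ∷ p)  (b ∷ q)  = (a ℤ.+ b) ∷ polyAdd p q

polyMul : Poly → Poly → Poly
polyMul []      q = []
polyMul (a ∷ p) q = polyAdd (map (a ℤ.*_) q) (+ 0 ∷ polyMul p q)

_∣ₚ_ : Poly → Poly → Set
f ∣ₚ g = Σ Poly λ h → ∀ i → coeff (polyMul f h) i ≡ coeff g i

quadratic : ℤ → ℤ → Poly
quadratic p q = q ∷ p ∷ + 1 ∷ []

-- for c = (c₁,…,c_r), the monic polynomial X^r - c₁X^{r-1} - … - c_r
charPoly : ∀ {r} → Vec ℤ r → Poly
charPoly c = reverse (map ℤ.-_ (toList c)) ++ (+ 1 ∷ [])

-- Roots α, β of X² + pX + q and the condition "α/β is a root of unity",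
-- expressed without complex numbers: α/β is a root of unity iff
-- αⁿ = βⁿ for some n ≥ 1, i.e. either α = β (discriminant p² - 4q = 0)
-- or α ≠ β and the Lucas sequence Uₙ = (αⁿ - βⁿ)/(α - β) vanishes for
-- some n ≥ 1.  Uₙ satisfies U₀ = 0, U₁ = 1, Uₙ₊₂ = -p Uₙ₊₁ - q Uₙ.

lucasU : ℤ → ℤ → ℕ → ℤ
lucasU p q zero          = + 0
lucasU p q (suc zero)    = + 1
lucasU p q (suc (suc n)) = (ℤ.- p) ℤ.* lucasU p q (suc n) ℤ.- q ℤ.* lucasU p q n

RatioIsRootOfUnity : ℤ → ℤ → Set
RatioIsRootOfUnity p q =
  (p ℤ.* p ℤ.- + 4 ℤ.* q ≡ + 0) ⊎ (Σ ℕ λ n → (n ≥ 1) × (lucasU p q n ≡ + 0))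

sumFin : (r : ℕ) → (Fin r → ℤ) → ℤ
sumFin zero    f = + 0
sumFin (suc r) f = f F.zero ℤ.+ sumFin r (λ i → f (F.suc i))

IsRecurrence : ∀ {r} → Vec ℤ r → (ℕ → ℤ) → Set
IsRecurrence {r} c s =
  ∀ n → s (n ℕ.+ r) ≡ sumFin r (λ i → lookup c i ℤ.* s (n ℕ.+ (r ∸ suc (toℕ i))))

-- s takes exactly m distinct residues modulo M = suc k
ExactlyResidues : (ℕ → ℤ) → ℕ → ℕ → Set
ExactlyResidues s k m =
  Σ (List ℕ) λ L → Unique L × length L ≡ m ×
    (∀ x → (x ∈ L) ⇔ (∃ λ n → (s n %ℕ suc k) ≡ x))

-- m ∈ 𝔐(g) where g = charPoly c
_∈𝔐_ : ℕ → ∀ {r} → Vec ℤ r → Set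
m ∈𝔐 c = Σ (ℕ → ℤ) λ s → IsRecurrence c s × (Σ ℕ λ k → ExactlyResidues s k m)

-- Put a = −p, so that recurrences with characteristic polynomial f = X² + pX − 1 satisfy
-- s (n + 2) = a s (n + 1) + s n.  If r is a root of X² − aX − 1 modulo M of multiplicative
-- order N, the solution with s₀ = 1 and s₁ = r is congruent to rⁿ, hence takes exactly N
-- residues modulo M; since f ∣ g it is also a recurrence for g.
--
-- Roots of odd order m = 2j + 1 ≥ 5 come from the Lucas sequences U, V of X² − bX − 1 with
-- b = ∣p∣ ≥ 1 (p = 0 would make α/β = −1).  Write U (m − 1) − 1 = g x and U m = g y with x, y
-- coprime, and let M = ∣x² + bxy − y²∣, the norm of x + yα.  As αᵐ − 1 = g (x + yα) has norm
-- −V m, we get V m = g² M, and g² ∣ 4 because (V m)² + 4 = (b² + 4) (U m)².  Then r = −x/y is a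
-- root modulo M with rᵐ ≡ 1, while rᵉ ≡ 1 for a proper divisor e of m would give M ∣ V e,
-- contradicting V m ≤ 4M ≤ 4 V e < V (e + 4) ≤ V m.  The inverse root handles the sign of p,
-- and minus the inverse is the other root of X² − aX − 1, of order 2m since M ≥ 3.

module Submission where

open import Defs
open import Data.Nat as ℕ using (ℕ; zero; suc; _∸_; _≤_; _<_; _≤′_; z≤n; s≤s; NonZero)
import Data.Nat.Properties as ℕₚ
open import Data.Nat.Coprimality as Coprimality using (Coprime)
open import Data.Nat.DivMod using (_%_; _/_; m≡m%n+[m/n]*n; m%n<n; m/n*n≡m)
open import Data.Nat.Divisibility as ℕ∣ using (_∣_; divides)
open import Data.Nat.GCD using (gcd; module Bézout; gcd-GCD; gcd[m,n]∣m; gcd[m,n]∣n; gcd[m,n]≢0)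
open import Data.Nat.Tactic.RingSolver using () renaming (solve-∀ to ℕ-solve-∀)
open import Data.Integer as ℤ using (ℤ; +_; -[1+_]; 0ℤ; 1ℤ; -1ℤ; _+_; _*_; -_; _-_; _^_; _%ℕ_; _/ℕ_)
import Data.Integer.Properties as ℤₚ
open import Data.Integer.DivMod using (a≡a%ℕn+[a/ℕn]*n; n%ℕd<d)
open import Data.Integer.Divisibility.Signed as ℤ∣ using () renaming (_∣_ to _∣ℤ_; divides to dividesℤ)
open import Data.Integer.Tactic.RingSolver using (solve-∀)
open import Data.Fin using (toℕ)
open import Data.Vec as Vec using (Vec; toList; lookup)
import Data.Vec.Properties as Vecₚ
open import Data.List using (List; []; _∷_; reverse; map; _++_; length; applyUpTo)
import Data.List.Properties as Listₚ
open import Data.List.Membership.Propositional using (_∈_)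
open import Data.List.Membership.Propositional.Properties using (∈-applyUpTo⁺; ∈-applyUpTo⁻)
open import Data.List.Relation.Unary.AllPairs.Properties using (applyUpTo⁺₁)
open import Data.List.Relation.Unary.Unique.Propositional using (Unique)
open import Data.Product using (∃; _×_; _,_; proj₁; proj₂)
open import Data.Sum using (inj₂)
open import Function.Bundles using (mk⇔)
open import Relation.Binary.Bundles using (Setoid)
open import Relation.Binary.Definitions using (tri<; tri≈; tri>)
open import Relation.Binary.PropositionalEquality
import Relation.Binary.Reasoning.Setoid as SetoidReasoning
open import Relation.Binary.Structures using (IsEquivalence)
open import Relation.Nullary using (¬_; contradiction)

^-distribʳ-* : ∀ x y n → (x * y) ^ n ≡ x ^ n * y ^ n
^-distribʳ-* x y zero    = refl
^-distribʳ-* x y (suc n) = trans (cong ((x * y) *_) (^-distribʳ-* x y n)) (identity x y (x ^ n) (y ^ n))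
  where
  identity : ∀ x y u v → x * y * (u * v) ≡ x * u * (y * v)
  identity = solve-∀

^-split : ∀ x {n} a b → n ≡ a ℕ.+ b → x ^ n ≡ x ^ a * x ^ b
^-split x a b refl = ℤₚ.^-distribˡ-+-* x a b

^-neg : ∀ x n → (- x) ^ n ≡ -1ℤ ^ n * x ^ n
^-neg x n = trans (cong (_^ n) (sym (ℤₚ.-1*i≡-i x))) (^-distribʳ-* -1ℤ x n)

-1^even : ∀ n → -1ℤ ^ (2 ℕ.* n) ≡ 1ℤ
-1^even n = trans (sym (ℤₚ.^-*-assoc -1ℤ 2 n)) (ℤₚ.^-zeroˡ n)

-1^odd : ∀ n → -1ℤ ^ suc (2 ℕ.* n) ≡ -1ℤ
-1^odd n = cong (-1ℤ *_) (-1^even n)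

odd⊥2 : ∀ j → Coprime (suc (2 ℕ.* j)) 2
odd⊥2 zero    (d∣1 , _) = ℕ∣.∣1⇒≡1 d∣1
odd⊥2 (suc j) = subst (λ n → Coprime n 2) (identity j) (Coprimality.coprime-+ (odd⊥2 j))
  where
  identity : ∀ j → 2 ℕ.+ suc (2 ℕ.* j) ≡ suc (2 ℕ.* suc j)
  identity = ℕ-solve-∀

data Parity : ℕ → Set where
  even : ∀ t → Parity (2 ℕ.* t)
  odd  : ∀ t → Parity (suc (2 ℕ.* t))

parity : ∀ n → Parity n
parity zero    = even 0
parity (suc n) with parity n
... | even t = odd t
... | odd t  = subst Parity (identity t) (even (suc t))
  where
  identity : ∀ t → 2 ℕ.* suc t ≡ suc (suc (2 ℕ.* t))
  identity = ℕ-solve-∀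

∣odd⇒odd : ∀ {e j} → e ∣ suc (2 ℕ.* j) → ∃ λ t → e ≡ suc (2 ℕ.* t)
∣odd⇒odd {e} {j} (divides q m≡qe) with parity e
... | odd t  = t , refl
... | even t = contradiction (trans (identity q t) (sym m≡qe)) (ℕₚ.even≢odd (q ℕ.* t) j)
  where
  identity : ∀ q t → 2 ℕ.* (q ℕ.* t) ≡ q ℕ.* (2 ℕ.* t)
  identity = ℕ-solve-∀

proper∣odd⇒3*≤ : ∀ {e j} → e ∣ suc (2 ℕ.* j) → e < suc (2 ℕ.* j) → 3 ℕ.* e ≤ suc (2 ℕ.* j)
proper∣odd⇒3*≤ (divides zero ())
proper∣odd⇒3*≤ {e} (divides 1 m≡e) e<m = contradiction (trans m≡e (ℕₚ.+-identityʳ e)) (ℕₚ.>⇒≢ e<m)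
proper∣odd⇒3*≤ {e} {j} (divides 2 m≡2e) e<m = contradiction (sym m≡2e) (ℕₚ.even≢odd e j)
proper∣odd⇒3*≤ {e} (divides (suc (suc (suc q))) m≡qe) _ =
  ℕₚ.≤-trans (ℕₚ.*-monoˡ-≤ e (s≤s (s≤s (s≤s (z≤n {q}))))) (ℕₚ.≤-reflexive (sym m≡qe))

4+e≤m : ∀ {e m} → 5 ≤ m → 3 ℕ.* e ≤ m → 4 ℕ.+ e ≤ m
4+e≤m {zero}        5≤m _    = ℕₚ.≤-trans (ℕₚ.n≤1+n 4) 5≤m
4+e≤m {suc zero}    5≤m _    = 5≤m
4+e≤m {suc (suc e)} _   3e≤m =
  ℕₚ.≤-trans (ℕₚ.+-monoʳ-≤ 6 (ℕₚ.m≤n*m e 3)) (ℕₚ.≤-trans (ℕₚ.≤-reflexive (identity e)) 3e≤m)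
  where
  identity : ∀ e → 6 ℕ.+ 3 ℕ.* e ≡ 3 ℕ.* suc (suc e)
  identity = ℕ-solve-∀

-- Polynomials acting on sequences

recSeq : ℤ → ℤ → ℤ → ℕ → ℤ
recSeq a s₀ s₁ zero          = s₀
recSeq a s₀ s₁ (suc zero)    = s₁
recSeq a s₀ s₁ (suc (suc n)) = a * recSeq a s₀ s₁ (suc n) + recSeq a s₀ s₁ n

-- act P s is P(E) s, where E is the shift (E s) n = s (suc n).
act : Poly → (ℕ → ℤ) → ℕ → ℤ
act []      s n = 0ℤ
act (a ∷ P) s n = a * s n + act P s (suc n)

act-polyAdd : ∀ P Q s n → act (polyAdd P Q) s n ≡ act P s n + act Q s n
act-polyAdd []      Q       s n = sym (ℤₚ.+-identityˡ (act Q s n))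
act-polyAdd (a ∷ P) []      s n = sym (ℤₚ.+-identityʳ (act (a ∷ P) s n))
act-polyAdd (a ∷ P) (b ∷ Q) s n =
  trans (cong (λ z → (a + b) * s n + z) (act-polyAdd P Q s (suc n))) (identity a b (s n) (act P s (suc n)) (act Q s (suc n)))
  where
  identity : ∀ a b x u v → (a + b) * x + (u + v) ≡ a * x + u + (b * x + v)
  identity = solve-∀

act-scale : ∀ a Q s n → act (map (a *_) Q) s n ≡ a * act Q s n
act-scale a []      s n = sym (ℤₚ.*-zeroʳ a)
act-scale a (b ∷ Q) s n =
  trans (cong (λ z → a * b * s n + z) (act-scale a Q s (suc n))) (identity a b (s n) (act Q s (suc n)))
  where
  identity : ∀ a b x u → a * b * x + a * u ≡ a * (b * x + u)
  identity = solve-∀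

act-linear : ∀ H a s t n → act H (λ j → a * s j + t j) n ≡ a * act H s n + act H t n
act-linear []      a s t n = sym (trans (ℤₚ.+-identityʳ (a * 0ℤ)) (ℤₚ.*-zeroʳ a))
act-linear (h ∷ H) a s t n =
  trans (cong (λ z → h * (a * s n + t n) + z) (act-linear H a s t (suc n)))
        (identity h a (s n) (t n) (act H s (suc n)) (act H t (suc n)))
  where
  identity : ∀ h a x y u v → h * (a * x + y) + (a * u + v) ≡ a * (h * x + u) + (h * y + v)
  identity = solve-∀

act-cong : ∀ H {s t} n → (∀ j → s j ≡ t j) → act H s n ≡ act H t n
act-cong []      n s≡t = refl
act-cong (h ∷ H) n s≡t = cong₂ (λ u v → h * u + v) (s≡t n) (act-cong H (suc n) s≡t)

act-zero : ∀ H n → act H (λ _ → 0ℤ) n ≡ 0ℤ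
act-zero []      n = refl
act-zero (h ∷ H) n = cong₂ _+_ (ℤₚ.*-zeroʳ h) (act-zero H (suc n))

act-shift : ∀ H s n → act H s (suc n) ≡ act H (λ j → s (suc j)) n
act-shift []      s n = refl
act-shift (h ∷ H) s n = cong (λ z → h * s (suc n) + z) (act-shift H s (suc n))

act-polyMul : ∀ F H s n → act (polyMul F H) s n ≡ act H (act F s) n
act-polyMul []      H s n = sym (act-zero H n)
act-polyMul (a ∷ F) H s n = begin
  act (polyAdd (map (a *_) H) (0ℤ ∷ polyMul F H)) s n
    ≡⟨ act-polyAdd (map (a *_) H) (0ℤ ∷ polyMul F H) s n ⟩
  act (map (a *_) H) s n + (0ℤ * s n + act (polyMul F H) s (suc n))
    ≡⟨ cong₂ (λ u v → u + (0ℤ * s n + v)) (act-scale a H s n)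
             (trans (act-polyMul F H s (suc n)) (act-shift H (act F s) n)) ⟩
  a * act H s n + (0ℤ * s n + act H (λ j → act F s (suc j)) n)
    ≡⟨ cong (λ z → a * act H s n + z) (ℤₚ.+-identityˡ _) ⟩
  a * act H s n + act H (λ j → act F s (suc j)) n
    ≡⟨ act-linear H a s (λ j → act F s (suc j)) n ⟨
  act H (act (a ∷ F) s) n
    ∎
  where open ≡-Reasoning

act-coeff≡0 : ∀ P s n → (∀ i → coeff P i ≡ 0ℤ) → act P s n ≡ 0ℤ
act-coeff≡0 []      s n _   = refl
act-coeff≡0 (a ∷ P) s n P≡0 =
  cong₂ (λ c v → c * s n + v) (P≡0 0) (act-coeff≡0 P s (suc n) (λ i → P≡0 (suc i)))

act-coeff : ∀ P Q s n → (∀ i → coeff P i ≡ coeff Q i) → act P s n ≡ act Q s n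
act-coeff []      Q       s n P≡Q = sym (act-coeff≡0 Q s n (λ i → sym (P≡Q i)))
act-coeff (a ∷ P) []      s n P≡Q = act-coeff≡0 (a ∷ P) s n P≡Q
act-coeff (a ∷ P) (b ∷ Q) s n P≡Q =
  cong₂ (λ c v → c * s n + v) (P≡Q 0) (act-coeff P Q s (suc n) (λ i → P≡Q (suc i)))

act-++ : ∀ P Q s n → act (P ++ Q) s n ≡ act P s n + act Q s (length P ℕ.+ n)
act-++ []      Q s n = sym (ℤₚ.+-identityˡ _)
act-++ (a ∷ P) Q s n = begin
  a * s n + act (P ++ Q) s (suc n)                          ≡⟨ cong (λ z → a * s n + z) (act-++ P Q s (suc n)) ⟩
  a * s n + (act P s (suc n) + act Q s (length P ℕ.+ suc n)) ≡⟨ ℤₚ.+-assoc (a * s n) _ _ ⟨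
  a * s n + act P s (suc n) + act Q s (length P ℕ.+ suc n)
    ≡⟨ cong (λ k → a * s n + act P s (suc n) + act Q s k) (ℕₚ.+-suc (length P) n) ⟩
  a * s n + act P s (suc n) + act Q s (suc (length P ℕ.+ n)) ∎
  where open ≡-Reasoning

act-∷ʳ : ∀ P a s n → act (P ++ a ∷ []) s n ≡ act P s n + a * s (length P ℕ.+ n)
act-∷ʳ P a s n = trans (act-++ P (a ∷ []) s n) (cong (λ z → act P s n + z) (ℤₚ.+-identityʳ _))

recurrenceSum : ∀ {r} → Vec ℤ r → (ℕ → ℤ) → ℕ → ℤ
recurrenceSum {r} c s n = sumFin r (λ i → lookup c i * s (n ℕ.+ (r ∸ suc (toℕ i))))

length-negatedCoefficients+ : ∀ {r} (c : Vec ℤ r) n → length (reverse (map -_ (toList c))) ℕ.+ n ≡ n ℕ.+ r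
length-negatedCoefficients+ {r} c n = begin
  length (reverse (map -_ (toList c))) ℕ.+ n  ≡⟨ cong (ℕ._+ n) (Listₚ.length-reverse (map -_ (toList c))) ⟩
  length (map -_ (toList c)) ℕ.+ n            ≡⟨ cong (ℕ._+ n) (Listₚ.length-map -_ (toList c)) ⟩
  length (toList c) ℕ.+ n                     ≡⟨ cong (ℕ._+ n) (Vecₚ.length-toList c) ⟩
  r ℕ.+ n                                     ≡⟨ ℕₚ.+-comm r n ⟩
  n ℕ.+ r                                     ∎
  where open ≡-Reasoning

act-negatedCoefficients : ∀ {r} (c : Vec ℤ r) s n → act (reverse (map -_ (toList c))) s n ≡ - recurrenceSum c s n
act-negatedCoefficients Vec.[]          s n = refl
act-negatedCoefficients {suc r} (a Vec.∷ c) s n = begin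
  act (reverse (- a ∷ map -_ (toList c))) s n
    ≡⟨ cong (λ P → act P s n) (Listₚ.unfold-reverse (- a) (map -_ (toList c))) ⟩
  act (reverse (map -_ (toList c)) ++ - a ∷ []) s n
    ≡⟨ act-∷ʳ (reverse (map -_ (toList c))) (- a) s n ⟩
  act (reverse (map -_ (toList c))) s n + - a * s (length (reverse (map -_ (toList c))) ℕ.+ n)
    ≡⟨ cong₂ (λ u k → u + - a * s k) (act-negatedCoefficients c s n) (length-negatedCoefficients+ c n) ⟩
  - recurrenceSum c s n + - a * s (n ℕ.+ r)
    ≡⟨ identity (recurrenceSum c s n) a (s (n ℕ.+ r)) ⟩
  - (a * s (n ℕ.+ r) + recurrenceSum c s n)
    ∎
  where
  open ≡-Reasoning
  identity : ∀ t a x → - t + - a * x ≡ - (a * x + t)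
  identity = solve-∀

act-charPoly : ∀ {r} (c : Vec ℤ r) s n → act (charPoly c) s n ≡ s (n ℕ.+ r) - recurrenceSum c s n
act-charPoly {r} c s n = begin
  act (reverse (map -_ (toList c)) ++ 1ℤ ∷ []) s n
    ≡⟨ act-∷ʳ (reverse (map -_ (toList c))) 1ℤ s n ⟩
  act (reverse (map -_ (toList c))) s n + 1ℤ * s (length (reverse (map -_ (toList c))) ℕ.+ n)
    ≡⟨ cong₂ (λ u k → u + 1ℤ * s k) (act-negatedCoefficients c s n) (length-negatedCoefficients+ c n) ⟩
  - recurrenceSum c s n + 1ℤ * s (n ℕ.+ r)
    ≡⟨ identity (recurrenceSum c s n) (s (n ℕ.+ r)) ⟩
  s (n ℕ.+ r) - recurrenceSum c s n
    ∎
  where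
  open ≡-Reasoning
  identity : ∀ t x → - t + 1ℤ * x ≡ x - t
  identity = solve-∀

annihilates-multiple : ∀ {f g s} → f ∣ₚ g → (∀ n → act f s n ≡ 0ℤ) → ∀ n → act g s n ≡ 0ℤ
annihilates-multiple {f} {g} {s} (h , fh≡g) f[s]≡0 n = begin
  act g s n                ≡⟨ act-coeff (polyMul f h) g s n fh≡g ⟨
  act (polyMul f h) s n    ≡⟨ act-polyMul f h s n ⟩
  act h (act f s) n        ≡⟨ act-cong h n f[s]≡0 ⟩
  act h (λ _ → 0ℤ) n       ≡⟨ act-zero h n ⟩
  0ℤ                       ∎
  where open ≡-Reasoning

isRecurrence-of-annihilated : ∀ {r} (c : Vec ℤ r) {s} → (∀ n → act (charPoly c) s n ≡ 0ℤ) → IsRecurrence c s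
isRecurrence-of-annihilated {r} c {s} g[s]≡0 n =
  ℤₚ.i-j≡0⇒i≡j (s (n ℕ.+ r)) (recurrenceSum c s n) (trans (sym (act-charPoly c s n)) (g[s]≡0 n))

recSeq-annihilated : ∀ p s₀ s₁ n → act (quadratic p -1ℤ) (recSeq (- p) s₀ s₁) n ≡ 0ℤ
recSeq-annihilated p s₀ s₁ n = identity p (recSeq (- p) s₀ s₁ n) (recSeq (- p) s₀ s₁ (suc n))
  where
  identity : ∀ p x y → -1ℤ * x + (p * y + (1ℤ * (- p * y + x) + 0ℤ)) ≡ 0ℤ
  identity = solve-∀

-- Congruences modulo M

module Congruence (M : ℕ) where

  -- A record rather than a function, so that x and y can be inferred from x ≈ y.
  infix 4 _≈_
  record _≈_ (x y : ℤ) : Set where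
    constructor ≈-intro
    field M∣x-y : + M ∣ℤ x - y

  private
    divides⇒≈ : ∀ {x y} e → e ≡ x - y → + M ∣ℤ e → x ≈ y
    divides⇒≈ e refl M∣e = ≈-intro M∣e

  ≈-reflexive : ∀ {x y} → x ≡ y → x ≈ y
  ≈-reflexive {x} refl = ≈-intro (dividesℤ 0ℤ (ℤₚ.+-inverseʳ x))

  ≈-refl : ∀ {x} → x ≈ x
  ≈-refl = ≈-reflexive refl

  ≈-sym : ∀ {x y} → x ≈ y → y ≈ x
  ≈-sym {x} {y} (≈-intro M∣x-y) = divides⇒≈ (- (x - y)) (identity x y) (ℤ∣.∣m⇒∣-m M∣x-y)
    where
    identity : ∀ x y → - (x - y) ≡ y - x
    identity = solve-∀

  ≈-trans : ∀ {x y z} → x ≈ y → y ≈ z → x ≈ z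
  ≈-trans {x} {y} {z} (≈-intro M∣x-y) (≈-intro M∣y-z) =
    divides⇒≈ ((x - y) + (y - z)) (identity x y z) (ℤ∣.∣m∣n⇒∣m+n M∣x-y M∣y-z)
    where
    identity : ∀ x y z → (x - y) + (y - z) ≡ x - z
    identity = solve-∀

  ≈-isEquivalence : IsEquivalence _≈_
  ≈-isEquivalence = record { refl = ≈-refl ; sym = ≈-sym ; trans = ≈-trans }

  ≈-setoid : Setoid _ _
  ≈-setoid = record { isEquivalence = ≈-isEquivalence }

  module ≈-Reasoning = SetoidReasoning ≈-setoid

  +-cong : ∀ {x x′ y y′} → x ≈ x′ → y ≈ y′ → x + y ≈ x′ + y′
  +-cong {x} {x′} {y} {y′} (≈-intro x≈x′) (≈-intro y≈y′) =
    divides⇒≈ ((x - x′) + (y - y′)) (identity x x′ y y′) (ℤ∣.∣m∣n⇒∣m+n x≈x′ y≈y′)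
    where
    identity : ∀ x x′ y y′ → (x - x′) + (y - y′) ≡ (x + y) - (x′ + y′)
    identity = solve-∀

  *-cong : ∀ {x x′ y y′} → x ≈ x′ → y ≈ y′ → x * y ≈ x′ * y′
  *-cong {x} {x′} {y} {y′} (≈-intro x≈x′) (≈-intro y≈y′) =
    divides⇒≈ ((x - x′) * y + x′ * (y - y′)) (identity x x′ y y′)
        (ℤ∣.∣m∣n⇒∣m+n (ℤ∣.∣m⇒∣m*n y x≈x′) (ℤ∣.∣n⇒∣m*n x′ y≈y′))
    where
    identity : ∀ x x′ y y′ → (x - x′) * y + x′ * (y - y′) ≡ x * y - x′ * y′
    identity = solve-∀

  -‿cong : ∀ {x x′} → x ≈ x′ → - x ≈ - x′
  -‿cong {x} {x′} (≈-intro x≈x′) = divides⇒≈ (- (x - x′)) (identity x x′) (ℤ∣.∣m⇒∣-m x≈x′)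
    where
    identity : ∀ x x′ → - (x - x′) ≡ - x - - x′
    identity = solve-∀

  ^-congˡ : ∀ {x x′} n → x ≈ x′ → x ^ n ≈ x′ ^ n
  ^-congˡ zero    x≈x′ = ≈-refl
  ^-congˡ (suc n) x≈x′ = *-cong x≈x′ (^-congˡ n x≈x′)

  *-congˡ : ∀ {x y y′} → y ≈ y′ → x * y ≈ x * y′
  *-congˡ {x} = *-cong (≈-refl {x})

  *-congʳ : ∀ {x x′ y} → x ≈ x′ → x * y ≈ x′ * y
  *-congʳ {y = y} x≈x′ = *-cong x≈x′ (≈-refl {y})

  +-congˡ : ∀ {x y y′} → y ≈ y′ → x + y ≈ x + y′
  +-congˡ {x} = +-cong (≈-refl {x})

  +-congʳ : ∀ {x x′ y} → x ≈ x′ → x + y ≈ x′ + y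
  +-congʳ {y = y} x≈x′ = +-cong x≈x′ (≈-refl {y})

  ≈0⇒∣ : ∀ {n} → + n ≈ 0ℤ → M ∣ n
  ≈0⇒∣ {n} (≈-intro n≈0) = subst (M ∣_) (ℕₚ.+-identityʳ n) (ℤ∣.∣⇒∣ᵤ n≈0)

  private
    pos-1+ab≡cd : ∀ a b c d → 1 ℕ.+ a ℕ.* b ≡ c ℕ.* d → 1ℤ + + a * + b ≡ + c * + d
    pos-1+ab≡cd a b c d e =
      trans (cong (λ z → 1ℤ + z) (sym (ℤₚ.pos-* a b)))
            (trans (sym (ℤₚ.pos-+ 1 (a ℕ.* b))) (trans (cong +_ e) (ℤₚ.pos-* c d)))

  coprime⇒invertible : ∀ {y} → Coprime y M → ∃ λ w → w * + y ≈ 1ℤ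
  coprime⇒invertible {y} y⊥M with Coprimality.coprime-Bézout y⊥M
  ... | Bézout.+- u v 1+vM≡uy =
    + u , ≈-intro (dividesℤ (+ v) (rearrange (+ u) (+ y) (+ v) (+ M) (pos-1+ab≡cd v M u y 1+vM≡uy)))
    where
    rearrange : ∀ u y v m → 1ℤ + v * m ≡ u * y → u * y - 1ℤ ≡ v * m
    rearrange u y v m e = trans (cong (_- 1ℤ) (sym e)) (identity (v * m))
      where
      identity : ∀ a → 1ℤ + a - 1ℤ ≡ a
      identity = solve-∀
  ... | Bézout.-+ u v 1+uy≡vM =
    - + u , ≈-intro (dividesℤ (- + v) (rearrange (+ u) (+ y) (+ v) (+ M) (pos-1+ab≡cd u y v M 1+uy≡vM)))
    where
    rearrange : ∀ u y v m → 1ℤ + u * y ≡ v * m → - u * y - 1ℤ ≡ - v * m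
    rearrange u y v m e = trans (identity₁ u y) (trans (cong -_ e) (identity₂ v m))
      where
      identity₁ : ∀ u y → - u * y - 1ℤ ≡ - (1ℤ + u * y)
      identity₁ = solve-∀
      identity₂ : ∀ v m → - (v * m) ≡ - v * m
      identity₂ = solve-∀

  residue-unique : ∀ {u v} → u < M → v < M → + u ≈ + v → u ≡ v
  residue-unique {u} {v} u<M v<M (≈-intro M∣u-v) =
    ℤₚ.+-injective (ℤₚ.i-j≡0⇒i≡j (+ u) (+ v)
      (ℤₚ.∣i∣≡0⇒i≡0 (small-multiple≡0 (ℤ∣.∣⇒∣ᵤ M∣u-v) ∣u-v∣<M)))
    where
    ∣u-v∣<M : ℤ.∣ + u - + v ∣ < M
    ∣u-v∣<M = ℕₚ.≤-<-trans
      (subst (ℕ._≤ u ℕ.⊔ v) (cong ℤ.∣_∣ (sym (ℤₚ.m-n≡m⊖n u v))) (ℤₚ.∣m⊝n∣≤m⊔n u v))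
      (ℕₚ.⊔-lub u<M v<M)
    small-multiple≡0 : ∀ {n} → M ∣ n → n < M → n ≡ 0
    small-multiple≡0 {zero}  _   _   = refl
    small-multiple≡0 {suc n} M∣n n<M = contradiction M∣n (ℕ∣.>⇒∤ n<M)

  ≈-%ℕ : ∀ x .{{_ : NonZero M}} → x ≈ + (x %ℕ M)
  ≈-%ℕ x = ≈-intro (dividesℤ (x /ℕ M) (rearrange x _ _ (a≡a%ℕn+[a/ℕn]*n x M)))
    where
    rearrange : ∀ x r q → x ≡ r + q → x - r ≡ q
    rearrange x r q refl = identity r q
      where
      identity : ∀ r q → r + q - r ≡ q
      identity = solve-∀

  ≈⇒%ℕ≡ : ∀ {x y} .{{_ : NonZero M}} → x ≈ y → x %ℕ M ≡ y %ℕ M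
  ≈⇒%ℕ≡ {x} {y} x≈y =
    residue-unique (n%ℕd<d x M) (n%ℕd<d y M) (≈-trans (≈-sym (≈-%ℕ x)) (≈-trans x≈y (≈-%ℕ y)))

  %ℕ≡⇒≈ : ∀ {x y} .{{_ : NonZero M}} → x %ℕ M ≡ y %ℕ M → x ≈ y
  %ℕ≡⇒≈ {x} {y} eq = ≈-trans (≈-%ℕ x) (≈-trans (≈-reflexive (cong +_ eq)) (≈-sym (≈-%ℕ y)))

  -1≉1 : 3 ≤ M → ¬ -1ℤ ≈ 1ℤ
  -1≉1 3≤M (≈-intro M∣-2) = ℕₚ.<⇒≱ 3≤M (ℕ∣.∣⇒≤ (ℤ∣.∣⇒∣ᵤ M∣-2))

module Order (M : ℕ) where
  open Congruence M

  ≈1⇒^≈1 : ∀ {x} n → x ≈ 1ℤ → x ^ n ≈ 1ℤ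
  ≈1⇒^≈1 n x≈1 = ≈-trans (^-congˡ n x≈1) (≈-reflexive (ℤₚ.^-zeroˡ n))

  ^*≈1 : ∀ {x} n k → x ^ n ≈ 1ℤ → x ^ (k ℕ.* n) ≈ 1ℤ
  ^*≈1 {x} n k xⁿ≈1 = begin
    x ^ (k ℕ.* n)  ≡⟨ cong (x ^_) (ℕₚ.*-comm k n) ⟩
    x ^ (n ℕ.* k)  ≡⟨ ℤₚ.^-*-assoc x n k ⟨
    (x ^ n) ^ k    ≈⟨ ≈1⇒^≈1 k xⁿ≈1 ⟩
    1ℤ             ∎
    where open ≈-Reasoning

  ^-cancel : ∀ {x} e a → x ^ a ≈ 1ℤ → x ^ (e ℕ.+ a) ≈ 1ℤ → x ^ e ≈ 1ℤ
  ^-cancel {x} e a xᵃ≈1 xᵉ⁺ᵃ≈1 = begin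
    x ^ e          ≡⟨ ℤₚ.*-identityʳ (x ^ e) ⟨
    x ^ e * 1ℤ     ≈⟨ *-congˡ {x ^ e} xᵃ≈1 ⟨
    x ^ e * x ^ a  ≡⟨ ℤₚ.^-distribˡ-+-* x e a ⟨
    x ^ (e ℕ.+ a)  ≈⟨ xᵉ⁺ᵃ≈1 ⟩
    1ℤ             ∎
    where open ≈-Reasoning

  ^-gcd≈1 : ∀ {x} d m → x ^ d ≈ 1ℤ → x ^ m ≈ 1ℤ → x ^ gcd d m ≈ 1ℤ
  ^-gcd≈1 {x} d m xᵈ≈1 xᵐ≈1 with Bézout.identity (gcd-GCD d m)
  ... | Bézout.+- u v g+vm≡ud =
    ^-cancel (gcd d m) (v ℕ.* m) (^*≈1 m v xᵐ≈1) (subst (λ n → x ^ n ≈ 1ℤ) (sym g+vm≡ud) (^*≈1 d u xᵈ≈1))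
  ... | Bézout.-+ u v g+ud≡vm =
    ^-cancel (gcd d m) (u ℕ.* d) (^*≈1 d u xᵈ≈1) (subst (λ n → x ^ n ≈ 1ℤ) (sym g+ud≡vm) (^*≈1 m v xᵐ≈1))

  ^-mod : ∀ {x} N .{{_ : NonZero N}} → x ^ N ≈ 1ℤ → ∀ n → x ^ n ≈ x ^ (n % N)
  ^-mod {x} N xᴺ≈1 n = begin
    x ^ n                            ≡⟨ ^-split x (n % N) (n / N ℕ.* N) (m≡m%n+[m/n]*n n N) ⟩
    x ^ (n % N) * x ^ (n / N ℕ.* N)  ≈⟨ *-congˡ {x ^ (n % N)} (^*≈1 N (n / N) xᴺ≈1) ⟩
    x ^ (n % N) * 1ℤ                 ≡⟨ ℤₚ.*-identityʳ (x ^ (n % N)) ⟩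
    x ^ (n % N)                      ∎
    where open ≈-Reasoning

  ^-gap : ∀ {x N i j} → x ^ N ≈ 1ℤ → i ≤ N → i ≤ j → x ^ i ≈ x ^ j → x ^ (j ∸ i) ≈ 1ℤ
  ^-gap {x} {N} {i} {j} xᴺ≈1 i≤N i≤j xⁱ≈xʲ = begin
    x ^ (j ∸ i)                          ≡⟨ ℤₚ.*-identityˡ (x ^ (j ∸ i)) ⟨
    1ℤ * x ^ (j ∸ i)                     ≈⟨ *-congʳ xᴺ≈1 ⟨
    x ^ N * x ^ (j ∸ i)                  ≡⟨ cong (_* x ^ (j ∸ i)) (^-split x (N ∸ i) i (sym (ℕₚ.m∸n+n≡m i≤N))) ⟩
    x ^ (N ∸ i) * x ^ i * x ^ (j ∸ i)    ≡⟨ ℤₚ.*-assoc (x ^ (N ∸ i)) (x ^ i) (x ^ (j ∸ i)) ⟩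
    x ^ (N ∸ i) * (x ^ i * x ^ (j ∸ i))  ≡⟨ cong (x ^ (N ∸ i) *_) (^-split x i (j ∸ i) (sym (ℕₚ.m+[n∸m]≡n i≤j))) ⟨
    x ^ (N ∸ i) * x ^ j                  ≈⟨ *-congˡ {x ^ (N ∸ i)} xⁱ≈xʲ ⟨
    x ^ (N ∸ i) * x ^ i                  ≡⟨ ^-split x (N ∸ i) i (sym (ℕₚ.m∸n+n≡m i≤N)) ⟨
    x ^ N                                ≈⟨ xᴺ≈1 ⟩
    1ℤ                                   ∎
    where open ≈-Reasoning

  ^≈1-of-product : ∀ {x y} n → (x * y) ^ n ≈ 1ℤ → x ^ n ≈ 1ℤ → y ^ n ≈ 1ℤ
  ^≈1-of-product {x} {y} n xyⁿ≈1 xⁿ≈1 = begin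
    y ^ n          ≡⟨ ℤₚ.*-identityˡ (y ^ n) ⟨
    1ℤ * y ^ n     ≈⟨ *-congʳ xⁿ≈1 ⟨
    x ^ n * y ^ n  ≡⟨ ^-distribʳ-* x y n ⟨
    (x * y) ^ n    ≈⟨ xyⁿ≈1 ⟩
    1ℤ             ∎
    where open ≈-Reasoning

  record HasOrder (x : ℤ) (N : ℕ) : Set where
    field
      ^N≈1    : x ^ N ≈ 1ℤ
      minimal : ∀ {d} → 0 < d → d < N → ¬ x ^ d ≈ 1ℤ

  open HasOrder public

  below-order≈1⇒≡0 : ∀ {x N d} → HasOrder x N → d < N → x ^ d ≈ 1ℤ → d ≡ 0
  below-order≈1⇒≡0 {d = zero}  ord _   _    = refl
  below-order≈1⇒≡0 {d = suc _} ord d<N xᵈ≈1 = contradiction xᵈ≈1 (minimal ord (s≤s z≤n) d<N)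

  order∣ : ∀ {x N n} .{{_ : NonZero N}} → HasOrder x N → x ^ n ≈ 1ℤ → N ∣ n
  order∣ {x} {N} {n} ord xⁿ≈1 = ℕ∣.m%n≡0⇒n∣m n N
    (below-order≈1⇒≡0 ord (m%n<n n N) (≈-trans (≈-sym (^-mod N (^N≈1 ord) n)) xⁿ≈1))

  hasOrder-by-divisors : ∀ {x m} → x ^ m ≈ 1ℤ → (∀ e → e ∣ m → e < m → ¬ x ^ e ≈ 1ℤ) → HasOrder x m
  hasOrder-by-divisors {x} {m} xᵐ≈1 no-proper-divisor = record
    { ^N≈1    = xᵐ≈1
    ; minimal = λ {d} 0<d d<m xᵈ≈1 →
        no-proper-divisor (gcd d m) (gcd[m,n]∣n d m)
          (ℕₚ.≤-<-trans (ℕ∣.∣⇒≤ {{ℕ.>-nonZero 0<d}} (gcd[m,n]∣m d m)) d<m) (^-gcd≈1 d m xᵈ≈1 xᵐ≈1)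
    }

  hasOrder-inverse : ∀ {x y N} → x * y ≈ 1ℤ → HasOrder x N → HasOrder y N
  hasOrder-inverse {x} {y} {N} xy≈1 ord = record
    { ^N≈1    = ^≈1-of-product N (≈1⇒^≈1 N xy≈1) (^N≈1 ord)
    ; minimal = λ {d} 0<d d<N yᵈ≈1 →
        minimal ord 0<d d<N (^≈1-of-product d (≈1⇒^≈1 d yx≈1) yᵈ≈1)
    }
    where
    yx≈1 : y * x ≈ 1ℤ
    yx≈1 = ≈-trans (≈-reflexive (ℤₚ.*-comm y x)) xy≈1

  ^-injective : ∀ {x N i j} → HasOrder x N → i < N → j < N → x ^ i ≈ x ^ j → i ≡ j
  ^-injective {x} {N} {i} {j} ord i<N j<N xⁱ≈xʲ with ℕₚ.<-cmp i j
  ... | tri< i<j _ _ = contradiction (^-gap (^N≈1 ord) (ℕₚ.<⇒≤ i<N) (ℕₚ.<⇒≤ i<j) xⁱ≈xʲ)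
                         (minimal ord (ℕₚ.m<n⇒0<n∸m i<j) (ℕₚ.≤-<-trans (ℕₚ.m∸n≤m j i) j<N))
  ... | tri≈ _ i≡j _ = i≡j
  ... | tri> _ _ j<i = contradiction (^-gap (^N≈1 ord) (ℕₚ.<⇒≤ j<N) (ℕₚ.<⇒≤ j<i) (≈-sym xⁱ≈xʲ))
                         (minimal ord (ℕₚ.m<n⇒0<n∸m j<i) (ℕₚ.≤-<-trans (ℕₚ.m∸n≤m i j) i<N))

  -- If (−x)ᵈ ≡ 1 then x²ᵈ ≡ 1, so the odd N divides d; d < 2N forces d = N, but (−x)ᴺ ≡ −1.
  hasOrder-neg : ∀ {x j} → 3 ≤ M → HasOrder x (suc (2 ℕ.* j)) → HasOrder (- x) (2 ℕ.* suc (2 ℕ.* j))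
  hasOrder-neg {x} {j} 3≤M ord = record
    { ^N≈1    = ≈-trans (≈-reflexive (-x^even N)) (^*≈1 {x} N 2 (^N≈1 ord))
    ; minimal = λ {d} 0<d d<2N -xᵈ≈1 → -1≉1 3≤M
        (-1≈1 (subst (λ e → (- x) ^ e ≈ 1ℤ) (N-multiple-below-2N 0<d d<2N (N∣d -xᵈ≈1)) -xᵈ≈1))
    }
    where
    N : ℕ
    N = suc (2 ℕ.* j)
    -x^even : ∀ n → (- x) ^ (2 ℕ.* n) ≡ x ^ (2 ℕ.* n)
    -x^even n = trans (^-neg x (2 ℕ.* n)) (trans (cong (_* x ^ (2 ℕ.* n)) (-1^even n)) (ℤₚ.*-identityˡ _))
    N∣d : ∀ {d} → (- x) ^ d ≈ 1ℤ → N ∣ d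
    N∣d {d} -xᵈ≈1 = Coprimality.coprime-divisor (odd⊥2 j)
      (order∣ ord (≈-trans (≈-reflexive (sym (-x^even d))) (^*≈1 d 2 -xᵈ≈1)))
    N-multiple-below-2N : ∀ {d} → 0 < d → d < 2 ℕ.* N → N ∣ d → d ≡ N
    N-multiple-below-2N 0<d d<2N (divides zero refl) = contradiction 0<d (ℕₚ.<-irrefl refl)
    N-multiple-below-2N 0<d d<2N (divides 1 refl) = ℕₚ.+-identityʳ N
    N-multiple-below-2N 0<d d<2N (divides (suc (suc q)) refl) =
      contradiction d<2N (ℕₚ.≤⇒≯ (ℕₚ.*-monoˡ-≤ N (s≤s (s≤s (z≤n {q})))))
    -1≈1 : (- x) ^ N ≈ 1ℤ → -1ℤ ≈ 1ℤ
    -1≈1 -xᴺ≈1 = begin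
      -1ℤ              ≡⟨ ℤₚ.*-identityʳ -1ℤ ⟨
      -1ℤ * 1ℤ         ≈⟨ *-congˡ { -1ℤ} (^N≈1 ord) ⟨
      -1ℤ * x ^ N      ≡⟨ cong (_* x ^ N) (-1^odd j) ⟨
      -1ℤ ^ N * x ^ N  ≡⟨ ^-neg x N ⟨
      (- x) ^ N        ≈⟨ -xᴺ≈1 ⟩
      1ℤ               ∎
      where open ≈-Reasoning

quadraticAt : ℤ → ℤ → ℤ
quadraticAt a r = r * r - a * r - 1ℤ

module Roots (M : ℕ) where
  open Congruence M

  IsRoot : ℤ → ℤ → Set
  IsRoot a r = quadraticAt a r ≈ 0ℤ

  root-inverse : ∀ {a r} → IsRoot a r → IsRoot (- a) (r - a)
  root-inverse {a} {r} = ≈-trans (≈-reflexive (identity a r))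
    where
    identity : ∀ a r → (r - a) * (r - a) - (- a) * (r - a) - 1ℤ ≡ r * r - a * r - 1ℤ
    identity = solve-∀

  root-neg : ∀ {a r} → IsRoot a r → IsRoot (- a) (- r)
  root-neg {a} {r} = ≈-trans (≈-reflexive (identity a r))
    where
    identity : ∀ a r → (- r) * (- r) - (- a) * (- r) - 1ℤ ≡ r * r - a * r - 1ℤ
    identity = solve-∀

  root-unit : ∀ {a r} → IsRoot a r → r * (r - a) ≈ 1ℤ
  root-unit {a} {r} root = begin
    r * (r - a)               ≡⟨ identity a r ⟩
    quadraticAt a r + 1ℤ      ≈⟨ +-congʳ root ⟩
    0ℤ + 1ℤ                   ≡⟨⟩
    1ℤ                        ∎
    where
    open ≈-Reasoning
    identity : ∀ a r → r * (r - a) ≡ (r * r - a * r - 1ℤ) + 1ℤ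
    identity = solve-∀

  root-^-recurrence : ∀ {a r} → IsRoot a r → ∀ n → r ^ suc (suc n) ≈ a * r ^ suc n + r ^ n
  root-^-recurrence {a} {r} root n = begin
    r * (r * r ^ n)                                      ≡⟨ identity a r (r ^ n) ⟩
    r ^ n * quadraticAt a r + (a * (r * r ^ n) + r ^ n)  ≈⟨ +-congʳ (*-congˡ {r ^ n} root) ⟩
    r ^ n * 0ℤ + (a * (r * r ^ n) + r ^ n)               ≡⟨ identity₀ (r ^ n) (a * (r * r ^ n) + r ^ n) ⟩
    a * (r * r ^ n) + r ^ n                              ∎
    where
    open ≈-Reasoning
    identity : ∀ a r p → r * (r * p) ≡ p * (r * r - a * r - 1ℤ) + (a * (r * p) + p)
    identity = solve-∀
    identity₀ : ∀ p q → p * 0ℤ + q ≡ q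
    identity₀ = solve-∀

  recSeq≈^ : ∀ {a r} → IsRoot a r → ∀ n → recSeq a 1ℤ r n ≈ r ^ n
  recSeq≈^ {a} {r} root n = proj₁ (pair n)
    where
    s : ℕ → ℤ
    s = recSeq a 1ℤ r
    pair : ∀ n → s n ≈ r ^ n × s (suc n) ≈ r ^ suc n
    pair zero    = ≈-refl , ≈-reflexive (sym (ℤₚ.*-identityʳ r))
    pair (suc n) with pair n
    ... | sₙ≈rⁿ , sₙ₊₁≈rⁿ⁺¹ =
      sₙ₊₁≈rⁿ⁺¹ ,
      ≈-trans (+-cong (*-congˡ {a} sₙ₊₁≈rⁿ⁺¹) sₙ≈rⁿ) (≈-sym (root-^-recurrence {a} {r} root n))

module _ (k : ℕ) where
  open Congruence (suc k)
  open Order (suc k)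

  exactlyResidues-of-powers : ∀ {s r N} .{{_ : NonZero N}} → HasOrder r N → (∀ n → s n ≈ r ^ n) →
                              ExactlyResidues s k N
  exactlyResidues-of-powers {s} {r} {N} ord s≈rⁿ =
    residues , unique , Listₚ.length-applyUpTo residue N , λ x → mk⇔ (occurs x) (occurring x)
    where
    residue : ℕ → ℕ
    residue i = r ^ i %ℕ suc k
    residues : List ℕ
    residues = applyUpTo residue N
    unique : Unique residues
    unique = applyUpTo⁺₁ residue N λ i<j j<N rⁱ≡rʲ →
      ℕₚ.<⇒≢ i<j (^-injective ord (ℕₚ.<-trans i<j j<N) j<N (%ℕ≡⇒≈ rⁱ≡rʲ))
    occurs : ∀ x → x ∈ residues → ∃ λ n → s n %ℕ suc k ≡ x
    occurs x x∈ with ∈-applyUpTo⁻ residue x∈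
    ... | i , _ , refl = i , ≈⇒%ℕ≡ (s≈rⁿ i)
    occurring : ∀ x → (∃ λ n → s n %ℕ suc k ≡ x) → x ∈ residues
    occurring x (n , refl) = subst (_∈ residues) (sym (≈⇒%ℕ≡ (≈-trans (s≈rⁿ n) (^-mod N (^N≈1 ord) n))))
                                   (∈-applyUpTo⁺ residue (m%n<n n N))

-- Lucas sequences

module Lucas (b : ℕ) where

  U : ℕ → ℕ
  U zero          = 0
  U (suc zero)    = 1
  U (suc (suc n)) = b ℕ.* U (suc n) ℕ.+ U n

  V : ℕ → ℕ
  V zero          = 2
  V (suc zero)    = b
  V (suc (suc n)) = b ℕ.* V (suc n) ℕ.+ V n

  -- The norm of x + yα, for α a root of X² − bX − 1.
  normForm : ℤ → ℤ → ℤ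
  normForm x y = x * x + + b * x * y - y * y

  normForm-factor : ∀ r x y → normForm x y ≡ (x + r * y) * (x + (+ b - r) * y) + y * y * quadraticAt (+ b) r
  normForm-factor r x y = identity (+ b) r x y
    where
    identity : ∀ b r x y → x * x + b * x * y - y * y
                           ≡ (x + r * y) * (x + (b - r) * y) + y * y * (r * r - b * r - 1ℤ)
    identity = solve-∀

  +U-rec : ∀ n → + U (suc (suc n)) ≡ + b * + U (suc n) + + U n
  +U-rec n = trans (ℤₚ.pos-+ (b ℕ.* U (suc n)) (U n)) (cong (_+ + U n) (ℤₚ.pos-* b (U (suc n))))

  cassini : ∀ n → normForm (+ U n) (+ U (suc n)) ≡ -1ℤ ^ suc n
  cassini zero    = identity (+ b)
    where
    identity : ∀ b → 0ℤ * 0ℤ + b * 0ℤ * 1ℤ - 1ℤ * 1ℤ ≡ -1ℤ * 1ℤ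
    identity = solve-∀
  cassini (suc n) = begin
    normForm (+ U (suc n)) (+ U (suc (suc n)))       ≡⟨ cong (normForm (+ U (suc n))) (+U-rec n) ⟩
    normForm (+ U (suc n)) (+ b * + U (suc n) + + U n) ≡⟨ identity (+ b) (+ U n) (+ U (suc n)) ⟩
    -1ℤ * normForm (+ U n) (+ U (suc n))              ≡⟨ cong (-1ℤ *_) (cassini n) ⟩
    -1ℤ ^ suc (suc n)                                 ∎
    where
    open ≡-Reasoning
    identity : ∀ b u w → w * w + b * w * (b * w + u) - (b * w + u) * (b * w + u)
                         ≡ -1ℤ * (u * u + b * u * w - w * w)
    identity = solve-∀

  V≡bU+2U : ∀ n → V (suc n) ≡ b ℕ.* U (suc n) ℕ.+ 2 ℕ.* U n
  V≡bU+2U zero          = identity b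
    where
    identity : ∀ b → b ≡ b ℕ.* 1 ℕ.+ 2 ℕ.* 0
    identity = ℕ-solve-∀
  V≡bU+2U (suc zero)    = identity b
    where
    identity : ∀ b → b ℕ.* b ℕ.+ 2 ≡ b ℕ.* (b ℕ.* 1 ℕ.+ 0) ℕ.+ 2 ℕ.* 1
    identity = ℕ-solve-∀
  V≡bU+2U (suc (suc n)) = begin
    b ℕ.* V (suc (suc n)) ℕ.+ V (suc n)
      ≡⟨ cong₂ (λ v v′ → b ℕ.* v ℕ.+ v′) (V≡bU+2U (suc n)) (V≡bU+2U n) ⟩
    b ℕ.* (b ℕ.* U (suc (suc n)) ℕ.+ 2 ℕ.* U (suc n)) ℕ.+ (b ℕ.* U (suc n) ℕ.+ 2 ℕ.* U n)
      ≡⟨ identity b (U (suc (suc n))) (U (suc n)) (U n) ⟩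
    b ℕ.* (b ℕ.* U (suc (suc n)) ℕ.+ U (suc n)) ℕ.+ 2 ℕ.* (b ℕ.* U (suc n) ℕ.+ U n)
      ∎
    where
    open ≡-Reasoning
    identity : ∀ b u₂ u₁ u₀ → b ℕ.* (b ℕ.* u₂ ℕ.+ 2 ℕ.* u₁) ℕ.+ (b ℕ.* u₁ ℕ.+ 2 ℕ.* u₀)
                             ≡ b ℕ.* (b ℕ.* u₂ ℕ.+ u₁) ℕ.+ 2 ℕ.* (b ℕ.* u₁ ℕ.+ u₀)
    identity = ℕ-solve-∀

  +V≡bU+2U : ∀ n → + V (suc n) ≡ + b * + U (suc n) + + 2 * + U n
  +V≡bU+2U n = begin
    + V (suc n)                                   ≡⟨ cong +_ (V≡bU+2U n) ⟩
    + (b ℕ.* U (suc n) ℕ.+ 2 ℕ.* U n)             ≡⟨ ℤₚ.pos-+ (b ℕ.* U (suc n)) (2 ℕ.* U n) ⟩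
    + (b ℕ.* U (suc n)) + + (2 ℕ.* U n)           ≡⟨ cong₂ _+_ (ℤₚ.pos-* b (U (suc n))) (ℤₚ.pos-* 2 (U n)) ⟩
    + b * + U (suc n) + + 2 * + U n               ∎
    where open ≡-Reasoning

  normForm-oddCassini : ∀ t → normForm (+ U (2 ℕ.* t)) (+ U (suc (2 ℕ.* t))) ≡ -1ℤ
  normForm-oddCassini t = trans (cassini (2 ℕ.* t)) (-1^odd t)

  normForm[U-1,U] : ∀ t → normForm (+ U (2 ℕ.* t) - 1ℤ) (+ U (suc (2 ℕ.* t))) ≡ - + V (suc (2 ℕ.* t))
  normForm[U-1,U] t = begin
    normForm (u - 1ℤ) w                      ≡⟨ identity (+ b) u w ⟩
    normForm u w + 1ℤ - (+ b * w + + 2 * u)  ≡⟨ cong₂ (λ c v → c + 1ℤ - v) (normForm-oddCassini t)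
                                                         (sym (+V≡bU+2U (2 ℕ.* t))) ⟩
    -1ℤ + 1ℤ - + V (suc (2 ℕ.* t))           ≡⟨ ℤₚ.+-identityˡ _ ⟩
    - + V (suc (2 ℕ.* t))                    ∎
    where
    open ≡-Reasoning
    u w : ℤ
    u = + U (2 ℕ.* t)
    w = + U (suc (2 ℕ.* t))
    identity : ∀ b u w → (u - 1ℤ) * (u - 1ℤ) + b * (u - 1ℤ) * w - w * w
                         ≡ (u * u + b * u * w - w * w) + 1ℤ - (b * w + + 2 * u)
    identity = solve-∀

  V²+4≡[b²+4]U² : ∀ t → let m = suc (2 ℕ.* t) in V m ℕ.* V m ℕ.+ 4 ≡ (b ℕ.* b ℕ.+ 4) ℕ.* (U m ℕ.* U m)
  V²+4≡[b²+4]U² t = ℤₚ.+-injective (begin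
    + (V m ℕ.* V m ℕ.+ 4)
      ≡⟨ trans (ℤₚ.pos-+ (V m ℕ.* V m) 4) (cong (_+ + 4) (ℤₚ.pos-* (V m) (V m))) ⟩
    + V m * + V m + + 4
      ≡⟨ cong (λ v → v * v + + 4) (+V≡bU+2U (2 ℕ.* t)) ⟩
    (+ b * w + + 2 * u) * (+ b * w + + 2 * u) + + 4
      ≡⟨ identity (+ b) u w ⟩
    (+ b * + b + + 4) * (w * w) + + 4 * (normForm u w + 1ℤ)
      ≡⟨ cong (λ c → (+ b * + b + + 4) * (w * w) + + 4 * (c + 1ℤ)) (normForm-oddCassini t) ⟩
    (+ b * + b + + 4) * (w * w) + + 4 * (-1ℤ + 1ℤ)
      ≡⟨ ℤₚ.+-identityʳ _ ⟩
    (+ b * + b + + 4) * (w * w)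
      ≡⟨ cong₂ _*_ (trans (ℤₚ.pos-+ (b ℕ.* b) 4) (cong (_+ + 4) (ℤₚ.pos-* b b))) (ℤₚ.pos-* (U m) (U m)) ⟨
    + (b ℕ.* b ℕ.+ 4) * + (U m ℕ.* U m)
      ≡⟨ ℤₚ.pos-* (b ℕ.* b ℕ.+ 4) (U m ℕ.* U m) ⟨
    + ((b ℕ.* b ℕ.+ 4) ℕ.* (U m ℕ.* U m))
      ∎)
    where
    open ≡-Reasoning
    m : ℕ
    m = suc (2 ℕ.* t)
    u w : ℤ
    u = + U (2 ℕ.* t)
    w = + U m
    identity : ∀ b u w → (b * w + + 2 * u) * (b * w + + 2 * u) + + 4
                         ≡ (b * b + + 4) * (w * w) + + 4 * ((u * u + b * u * w - w * w) + 1ℤ)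
    identity = solve-∀

  module Growth (1≤b : 1 ≤ b) where
    open ℕₚ.≤-Reasoning

    V-pos : ∀ n → 0 < V n
    V-pos zero          = s≤s z≤n
    V-pos (suc zero)    = 1≤b
    V-pos (suc (suc n)) = ℕₚ.≤-trans (V-pos n) (ℕₚ.m≤n+m (V n) (b ℕ.* V (suc n)))

    n≤b*n : ∀ n → n ≤ b ℕ.* n
    n≤b*n n = ℕₚ.≤-trans (ℕₚ.≤-reflexive (sym (ℕₚ.*-identityˡ n))) (ℕₚ.*-monoˡ-≤ n 1≤b)

    U-pos : ∀ n → 0 < U (suc n)
    U-pos zero    = s≤s z≤n
    U-pos (suc n) = ℕₚ.≤-trans (U-pos n) (ℕₚ.≤-trans (n≤b*n (U (suc n))) (ℕₚ.m≤m+n _ (U n)))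

    U-pos′ : ∀ {n} → 0 < n → 0 < U n
    U-pos′ {suc n} _ = U-pos n

    V-step : ∀ n → V (suc n) ℕ.+ V n ≤ V (suc (suc n))
    V-step n = ℕₚ.+-monoˡ-≤ (V n) (n≤b*n (V (suc n)))

    V-increasing : ∀ n → V (suc n) < V (suc (suc n))
    V-increasing n = ℕₚ.<-≤-trans (ℕₚ.m<m+n (V (suc n)) (V-pos n)) (V-step n)

    V-mono : ∀ {e m} → e ≤ m → V (suc e) ≤ V (suc m)
    V-mono e≤m = go (ℕₚ.≤⇒≤′ e≤m)
      where
      go : ∀ {e m} → e ≤′ m → V (suc e) ≤ V (suc m)
      go ℕ.≤′-refl                   = ℕₚ.≤-refl
      go {m = suc m} (ℕ.≤′-step e≤′m) = ℕₚ.≤-trans (go e≤′m) (ℕₚ.<⇒≤ (V-increasing m))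

    2V<V[2+] : ∀ n → 2 ℕ.* V (suc n) < V (suc (suc (suc n)))
    2V<V[2+] n = begin-strict
      2 ℕ.* V (suc n)                ≡⟨ cong (V (suc n) ℕ.+_) (ℕₚ.+-identityʳ (V (suc n))) ⟩
      V (suc n) ℕ.+ V (suc n)        <⟨ ℕₚ.+-monoˡ-< (V (suc n)) (V-increasing n) ⟩
      V (suc (suc n)) ℕ.+ V (suc n)  ≤⟨ V-step (suc n) ⟩
      V (suc (suc (suc n)))          ∎

    4V<V[4+] : ∀ n → 4 ℕ.* V (suc n) < V (4 ℕ.+ suc n)
    4V<V[4+] n = begin-strict
      4 ℕ.* V (suc n)              ≡⟨ ℕₚ.*-assoc 2 2 (V (suc n)) ⟩
      2 ℕ.* (2 ℕ.* V (suc n))      ≤⟨ ℕₚ.*-monoʳ-≤ 2 (ℕₚ.<⇒≤ (2V<V[2+] n)) ⟩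
      2 ℕ.* V (suc (suc (suc n)))  <⟨ 2V<V[2+] (suc (suc n)) ⟩
      V (4 ℕ.+ suc n)              ∎

    9≤V5 : 9 ≤ V 5
    9≤V5 = begin-strict
      8                 ≤⟨ ℕₚ.*-monoʳ-≤ 2 4≤V3 ⟩
      2 ℕ.* V 3         <⟨ 2V<V[2+] 2 ⟩
      V 5               ∎
      where
      4≤V3 : 4 ≤ V 3
      4≤V3 = ℕₚ.≤-trans (ℕₚ.+-mono-≤ (ℕₚ.+-monoˡ-≤ 2 (ℕₚ.*-mono-≤ 1≤b 1≤b)) 1≤b) (V-step 1)

-- Roots of prescribed order

module LucasRoots (M b : ℕ) where
  open Congruence M
  open Roots M
  open Lucas b

  root-^ : ∀ {r} → IsRoot (+ b) r → ∀ n → r ^ suc n ≈ + U (suc n) * r + + U n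
  root-^ {r} root zero    = ≈-reflexive (identity r)
    where
    identity : ∀ r → r * 1ℤ ≡ 1ℤ * r + 0ℤ
    identity = solve-∀
  root-^ {r} root (suc n) = begin
    r * r ^ suc n                                          ≈⟨ *-congˡ {r} (root-^ root n) ⟩
    r * (u₁ * r + u₀)                                      ≡⟨ identity (+ b) r u₁ u₀ ⟩
    u₁ * quadraticAt (+ b) r + ((+ b * u₁ + u₀) * r + u₁)  ≈⟨ +-congʳ (*-congˡ {u₁} root) ⟩
    u₁ * 0ℤ + ((+ b * u₁ + u₀) * r + u₁)                   ≡⟨ identity₀ u₁ ((+ b * u₁ + u₀) * r + u₁) ⟩
    (+ b * u₁ + u₀) * r + u₁                               ≡⟨ cong (λ u → u * r + u₁) (+U-rec n) ⟨
    + U (suc (suc n)) * r + u₁                             ∎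
    where
    open ≈-Reasoning
    u₁ u₀ : ℤ
    u₁ = + U (suc n)
    u₀ = + U n
    identity : ∀ b r u₁ u₀ → r * (u₁ * r + u₀) ≡ u₁ * (r * r - b * r - 1ℤ) + ((b * u₁ + u₀) * r + u₁)
    identity = solve-∀
    identity₀ : ∀ u z → u * 0ℤ + z ≡ z
    identity₀ = solve-∀

  normForm≈0 : ∀ {r x y} → IsRoot (+ b) r → x + r * y ≈ 0ℤ → normForm x y ≈ 0ℤ
  normForm≈0 {r} {x} {y} root x+ry≈0 = begin
    normForm x y
      ≡⟨ normForm-factor r x y ⟩
    (x + r * y) * (x + (+ b - r) * y) + y * y * quadraticAt (+ b) r
      ≈⟨ +-cong (*-congʳ x+ry≈0) (*-congˡ {y * y} root) ⟩
    0ℤ * (x + (+ b - r) * y) + y * y * 0ℤ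
      ≡⟨ identity₀ (x + (+ b - r) * y) (y * y) ⟩
    0ℤ
      ∎
    where
    open ≈-Reasoning
    identity₀ : ∀ p q → 0ℤ * p + q * 0ℤ ≡ 0ℤ
    identity₀ = solve-∀

  root-of-normForm≈0 : ∀ {r x y w} → w * y ≈ 1ℤ → x + r * y ≈ 0ℤ → normForm x y ≈ 0ℤ → IsRoot (+ b) r
  root-of-normForm≈0 {r} {x} {y} {w} wy≈1 x+ry≈0 N≈0 = begin
    Q                      ≡⟨ identity₁ Q ⟩
    1ℤ * 1ℤ * Q           ≈⟨ *-congʳ (*-cong wy≈1 wy≈1) ⟨
    w * y * (w * y) * Q    ≡⟨ identity₂ w y Q ⟩
    w * w * (y * y * Q)    ≈⟨ *-congˡ {w * w} y²Q≈0 ⟩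
    w * w * 0ℤ             ≡⟨ ℤₚ.*-zeroʳ (w * w) ⟩
    0ℤ                     ∎
    where
    open ≈-Reasoning
    Q : ℤ
    Q = quadraticAt (+ b) r
    y²Q≈0 : y * y * Q ≈ 0ℤ
    y²Q≈0 = begin
      y * y * Q                                         ≡⟨ rearrange (normForm-factor r x y) ⟩
      normForm x y - (x + r * y) * (x + (+ b - r) * y)  ≈⟨ +-cong N≈0 (-‿cong (*-congʳ x+ry≈0)) ⟩
      0ℤ - 0ℤ * (x + (+ b - r) * y)                     ≡⟨ cong (λ z → 0ℤ - z) (ℤₚ.*-zeroˡ (x + (+ b - r) * y)) ⟩
      0ℤ                                                ∎
      where
      rearrange : ∀ {n p q} → n ≡ p + q → q ≡ n - p
      rearrange {p = p} {q} refl = identity p q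
        where
        identity : ∀ p q → q ≡ p + q - p
        identity = solve-∀
    identity₁ : ∀ q → q ≡ 1ℤ * 1ℤ * q
    identity₁ = solve-∀
    identity₂ : ∀ w y q → w * y * (w * y) * q ≡ w * w * (y * y * q)
    identity₂ = solve-∀

  root-^odd≈1⇒V≈0 : ∀ {r} → IsRoot (+ b) r → ∀ t → r ^ suc (2 ℕ.* t) ≈ 1ℤ → + V (suc (2 ℕ.* t)) ≈ 0ℤ
  root-^odd≈1⇒V≈0 {r} root t rᵉ≈1 = begin
    + V e                              ≡⟨ ℤₚ.neg-involutive (+ V e) ⟨
    - - + V e                          ≡⟨ cong -_ (normForm[U-1,U] t) ⟨
    - normForm (u₀ - 1ℤ) u₁            ≈⟨ -‿cong (normForm≈0 {r} {u₀ - 1ℤ} {u₁} root x+ry≈0) ⟩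
    - 0ℤ                               ≡⟨⟩
    0ℤ                                 ∎
    where
    open ≈-Reasoning
    e : ℕ
    e = suc (2 ℕ.* t)
    u₀ u₁ : ℤ
    u₀ = + U (2 ℕ.* t)
    u₁ = + U e
    x+ry≈0 : (u₀ - 1ℤ) + r * u₁ ≈ 0ℤ
    x+ry≈0 = begin
      (u₀ - 1ℤ) + r * u₁   ≡⟨ identity u₀ u₁ r ⟩
      (u₁ * r + u₀) - 1ℤ   ≈⟨ +-congʳ (root-^ root (2 ℕ.* t)) ⟨
      r ^ e - 1ℤ           ≈⟨ +-congʳ rᵉ≈1 ⟩
      1ℤ - 1ℤ              ≡⟨⟩
      0ℤ                   ∎
      where
      identity : ∀ u₀ u₁ r → (u₀ - 1ℤ) + r * u₁ ≡ (u₁ * r + u₀) - 1ℤ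
      identity = solve-∀

module OddOrder (b′ j : ℕ) (2≤j : 2 ≤ j) where

  b : ℕ
  b = suc b′

  m : ℕ
  m = suc (2 ℕ.* j)

  open Lucas b
  open Growth (s≤s z≤n)

  A B : ℕ
  A = U (2 ℕ.* j) ∸ 1
  B = U m

  g : ℕ
  g = gcd A B

  instance
    g-nonZero : NonZero g
    g-nonZero = ℕ.≢-nonZero (gcd[m,n]≢0 A B (inj₂ (ℕₚ.>⇒≢ (U-pos (2 ℕ.* j)))))

  x y : ℕ
  x = A / g
  y = B / g

  x⊥y : Coprime x y
  x⊥y = Coprimality.coprime-/gcd A B

  +x*+g≡A : + x * + g ≡ + A
  +x*+g≡A = trans (sym (ℤₚ.pos-* x g)) (cong +_ (m/n*n≡m (gcd[m,n]∣m A B)))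

  +y*+g≡B : + y * + g ≡ + B
  +y*+g≡B = trans (sym (ℤₚ.pos-* y g)) (cong +_ (m/n*n≡m (gcd[m,n]∣n A B)))

  +A≡U-1 : + A ≡ + U (2 ℕ.* j) - 1ℤ
  +A≡U-1 = trans (sym (ℤₚ.⊖-≥ 1≤U)) (sym (ℤₚ.m-n≡m⊖n (U (2 ℕ.* j)) 1))
    where
    1≤U : 1 ≤ U (2 ℕ.* j)
    1≤U = U-pos′ (ℕₚ.≤-trans (s≤s z≤n) (ℕₚ.*-monoʳ-≤ 2 2≤j))

  Z : ℤ
  Z = normForm (+ x) (+ y)

  M : ℕ
  M = ℤ.∣ Z ∣

  g²Z≡-V : + g * + g * Z ≡ - + V m
  g²Z≡-V = begin
    + g * + g * normForm (+ x) (+ y)     ≡⟨ identity (+ b) (+ g) (+ x) (+ y) ⟩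
    normForm (+ x * + g) (+ y * + g)     ≡⟨ cong₂ normForm +x*+g≡A +y*+g≡B ⟩
    normForm (+ A) (+ B)                 ≡⟨ cong (λ a → normForm a (+ B)) +A≡U-1 ⟩
    normForm (+ U (2 ℕ.* j) - 1ℤ) (+ B)  ≡⟨ normForm[U-1,U] j ⟩
    - + V m                              ∎
    where
    open ≡-Reasoning
    identity : ∀ b g x y → g * g * (x * x + b * x * y - y * y)
                           ≡ (x * g) * (x * g) + b * (x * g) * (y * g) - (y * g) * (y * g)
    identity = solve-∀

  V≡g²M : V m ≡ g ℕ.* g ℕ.* M
  V≡g²M = begin
    V m                     ≡⟨ ℤₚ.∣-i∣≡∣i∣ (+ V m) ⟨
    ℤ.∣ - + V m ∣           ≡⟨ cong ℤ.∣_∣ g²Z≡-V ⟨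
    ℤ.∣ + g * + g * Z ∣     ≡⟨ ℤₚ.abs-* (+ g * + g) Z ⟩
    ℤ.∣ + g * + g ∣ ℕ.* M   ≡⟨ cong (ℕ._* M) (ℤₚ.abs-* (+ g) (+ g)) ⟩
    g ℕ.* g ℕ.* M           ∎
    where open ≡-Reasoning

  g²≤4 : g ℕ.* g ≤ 4
  g²≤4 = ℕ∣.∣⇒≤ (ℕ∣.∣m+n∣m⇒∣n g²∣V²+4 (ℕ∣.∣m⇒∣m*n (V m) g²∣V))
    where
    g∣B : g ∣ B
    g∣B = gcd[m,n]∣n A B
    g²∣V : g ℕ.* g ∣ V m
    g²∣V = divides M (trans V≡g²M (ℕₚ.*-comm (g ℕ.* g) M))
    g²∣V²+4 : g ℕ.* g ∣ V m ℕ.* V m ℕ.+ 4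
    g²∣V²+4 = subst (g ℕ.* g ∣_) (sym (V²+4≡[b²+4]U² j))
                (ℕ∣.∣n⇒∣m*n (b ℕ.* b ℕ.+ 4) (ℕ∣.*-pres-∣ g∣B g∣B))

  V≤4M : V m ≤ 4 ℕ.* M
  V≤4M = ℕₚ.≤-trans (ℕₚ.≤-reflexive V≡g²M) (ℕₚ.*-monoˡ-≤ M g²≤4)

  3≤M : 3 ≤ M
  3≤M = ℕₚ.*-cancelˡ-< 4 2 M (ℕₚ.≤-trans 9≤V5 (ℕₚ.≤-trans V5≤V V≤4M))
    where
    V5≤V : V 5 ≤ V m
    V5≤V = V-mono {4} {2 ℕ.* j} (ℕₚ.*-monoʳ-≤ 2 2≤j)

  y⊥M : Coprime y M
  y⊥M {d} (d∣y , d∣M) = x⊥y (Coprimality.coprime-divisor d⊥x d∣x*x , d∣y)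
    where
    d∣ℤy : + d ∣ℤ + y
    d∣ℤy = ℤ∣.∣ᵤ⇒∣ d∣y
    d∣ℤZ : + d ∣ℤ Z
    d∣ℤZ = ℤ∣.∣-trans (ℤ∣.∣ᵤ⇒∣ d∣M) ℤ∣.∣m∣∣m
    d∣x*x : d ∣ x ℕ.* x
    d∣x*x = subst (d ∣_) (ℤₚ.abs-* (+ x) (+ x)) (ℤ∣.∣⇒∣ᵤ (subst (+ d ∣ℤ_) (identity (+ b) (+ x) (+ y)) d∣Z-rest))
      where
      d∣Z-rest : + d ∣ℤ Z - (+ b * + x * + y - + y * + y)
      d∣Z-rest = ℤ∣.∣m∣n⇒∣m-n d∣ℤZ (ℤ∣.∣m∣n⇒∣m-n (ℤ∣.∣n⇒∣m*n (+ b * + x) d∣ℤy) (ℤ∣.∣m⇒∣m*n (+ y) d∣ℤy))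
      identity : ∀ b x y → (x * x + b * x * y - y * y) - (b * x * y - y * y) ≡ x * x
      identity = solve-∀
    d⊥x : Coprime d x
    d⊥x (e∣d , e∣x) = x⊥y (e∣x , ℕ∣.∣-trans e∣d d∣y)

  open Congruence M
  open Roots M
  open Order M
  open LucasRoots M b

  w : ℤ
  w = proj₁ (coprime⇒invertible y⊥M)

  wy≈1 : w * + y ≈ 1ℤ
  wy≈1 = proj₂ (coprime⇒invertible y⊥M)

  r : ℤ
  r = - + x * w

  x+ry≈0 : + x + r * + y ≈ 0ℤ
  x+ry≈0 = begin
    + x + r * + y               ≡⟨ identity (+ x) w (+ y) ⟩
    + x + - + x * (w * + y)     ≈⟨ +-congˡ {+ x} (*-congˡ { - + x} wy≈1) ⟩
    + x + - + x * 1ℤ            ≡⟨ identity₀ (+ x) ⟩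
    0ℤ                          ∎
    where
    open ≈-Reasoning
    identity : ∀ x w y → x + - x * w * y ≡ x + - x * (w * y)
    identity = solve-∀
    identity₀ : ∀ x → x + - x * 1ℤ ≡ 0ℤ
    identity₀ = solve-∀

  isRoot : IsRoot (+ b) r
  isRoot = root-of-normForm≈0 {r} {+ x} {+ y} {w} wy≈1 x+ry≈0 Z≈0
    where
    Z≈0 : Z ≈ 0ℤ
    Z≈0 = ≈-intro (subst (+ M ∣ℤ_) (sym (ℤₚ.+-identityʳ Z)) ℤ∣.∣m∣∣m)

  r^m≈1 : r ^ m ≈ 1ℤ
  r^m≈1 = begin
    r ^ m                                ≈⟨ root-^ {r} isRoot (2 ℕ.* j) ⟩
    + B * r + + U (2 ℕ.* j)              ≡⟨ cong₂ (λ u₁ u₀ → u₁ * r + u₀) (sym +y*+g≡B) U≡xg+1 ⟩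
    + y * + g * r + (+ x * + g + 1ℤ)     ≡⟨ identity (+ x) (+ y) (+ g) r ⟩
    + g * (+ x + r * + y) + 1ℤ           ≈⟨ +-congʳ (*-congˡ {+ g} x+ry≈0) ⟩
    + g * 0ℤ + 1ℤ                        ≡⟨ identity₀ (+ g) ⟩
    1ℤ                                   ∎
    where
    open ≈-Reasoning
    U≡xg+1 : + U (2 ℕ.* j) ≡ + x * + g + 1ℤ
    U≡xg+1 = trans (identity₁ (+ U (2 ℕ.* j))) (cong (_+ 1ℤ) (trans (sym +A≡U-1) (sym +x*+g≡A)))
      where
      identity₁ : ∀ u → u ≡ u - 1ℤ + 1ℤ
      identity₁ = solve-∀
    identity : ∀ x y g r → y * g * r + (x * g + 1ℤ) ≡ g * (x + r * y) + 1ℤ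
    identity = solve-∀
    identity₀ : ∀ g → g * 0ℤ + 1ℤ ≡ 1ℤ
    identity₀ = solve-∀

  no-odd-proper-divisor : ∀ t → 3 ℕ.* suc (2 ℕ.* t) ≤ m → ¬ r ^ suc (2 ℕ.* t) ≈ 1ℤ
  no-odd-proper-divisor t 3e≤m rᵉ≈1 = ℕₚ.<⇒≱ (ℕₚ.<-≤-trans (4V<V[4+] (2 ℕ.* t)) V[4+e]≤V) 4V≤
    where
    e : ℕ
    e = suc (2 ℕ.* t)
    M≤V : M ≤ V e
    M≤V = ℕ∣.∣⇒≤ {{ℕ.>-nonZero (V-pos e)}} (≈0⇒∣ (root-^odd≈1⇒V≈0 {r} isRoot t rᵉ≈1))
    V[4+e]≤V : V (4 ℕ.+ e) ≤ V m
    V[4+e]≤V = V-mono {3 ℕ.+ e} {2 ℕ.* j} (ℕₚ.≤-pred (4+e≤m {e} (s≤s (ℕₚ.*-monoʳ-≤ 2 2≤j)) 3e≤m))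
    4V≤ : V m ≤ 4 ℕ.* V e
    4V≤ = ℕₚ.≤-trans V≤4M (ℕₚ.*-monoʳ-≤ 4 M≤V)

  no-proper-divisor : ∀ e → e ∣ m → e < m → ¬ r ^ e ≈ 1ℤ
  no-proper-divisor e e∣m e<m rᵉ≈1 =
    no-odd-proper-divisor t (subst (λ n → 3 ℕ.* n ≤ m) e≡odd (proper∣odd⇒3*≤ {e} {j} e∣m e<m))
                            (subst (λ n → r ^ n ≈ 1ℤ) e≡odd rᵉ≈1)
    where
    t : ℕ
    t = proj₁ (∣odd⇒odd {e} {j} e∣m)
    e≡odd : e ≡ suc (2 ℕ.* t)
    e≡odd = proj₂ (∣odd⇒odd {e} {j} e∣m)

  hasOrder : HasOrder r m
  hasOrder = hasOrder-by-divisors {r} {m} r^m≈1 no-proper-divisor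

record RootOfOrder (a : ℤ) (N : ℕ) : Set where
  field
    modulus   : ℕ
    3≤modulus : 3 ≤ modulus
    root      : ℤ
    isRoot    : Roots.IsRoot modulus a root
    hasOrder  : Order.HasOrder modulus root N

rootOfOrder-inverse : ∀ {a N} → RootOfOrder a N → RootOfOrder (- a) N
rootOfOrder-inverse {a} {N} ρ = record
  { modulus   = modulus
  ; 3≤modulus = 3≤modulus
  ; root      = root - a
  ; isRoot    = Roots.root-inverse modulus {a} {root} isRoot
  ; hasOrder  = Order.hasOrder-inverse modulus {root} {root - a} {N} (Roots.root-unit modulus {a} {root} isRoot) hasOrder
  }
  where open RootOfOrder ρ

rootOfOrder-neg : ∀ {a j} → RootOfOrder a (suc (2 ℕ.* j)) → RootOfOrder (- a) (2 ℕ.* suc (2 ℕ.* j))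
rootOfOrder-neg {a} {j} ρ = record
  { modulus   = modulus
  ; 3≤modulus = 3≤modulus
  ; root      = - root
  ; isRoot    = Roots.root-neg modulus {a} {root} isRoot
  ; hasOrder  = Order.hasOrder-neg modulus {root} {j} 3≤modulus hasOrder
  }
  where open RootOfOrder ρ

rootOfOrder-double : ∀ {a j} → RootOfOrder a (suc (2 ℕ.* j)) → RootOfOrder a (2 ℕ.* suc (2 ℕ.* j))
rootOfOrder-double {a} {j} ρ =
  subst (λ a′ → RootOfOrder a′ (2 ℕ.* suc (2 ℕ.* j))) (ℤₚ.neg-involutive a)
        (rootOfOrder-neg {j = j} (rootOfOrder-inverse ρ))

rootOfOrder-odd⁺ : ∀ b′ j → 2 ≤ j → RootOfOrder (+ suc b′) (suc (2 ℕ.* j))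
rootOfOrder-odd⁺ b′ j 2≤j = record
  { modulus = M ; 3≤modulus = 3≤M ; root = r ; isRoot = isRoot ; hasOrder = hasOrder }
  where open OddOrder b′ j 2≤j

rootOfOrder-odd : ∀ p → p ≢ 0ℤ → ∀ j → 2 ≤ j → RootOfOrder (- p) (suc (2 ℕ.* j))
rootOfOrder-odd (+ zero)   p≢0 j 2≤j = contradiction refl p≢0
rootOfOrder-odd (+ suc b′) p≢0 j 2≤j = rootOfOrder-inverse (rootOfOrder-odd⁺ b′ j 2≤j)
rootOfOrder-odd -[1+ b′ ]  p≢0 j 2≤j = rootOfOrder-odd⁺ b′ j 2≤j

∈𝔐-of-rootOfOrder : ∀ {p N r} {c : Vec ℤ r} .{{_ : NonZero N}} →
                    quadratic p -1ℤ ∣ₚ charPoly c → RootOfOrder (- p) N → N ∈𝔐 c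
∈𝔐-of-rootOfOrder f∣g record { modulus = zero ; 3≤modulus = () }
∈𝔐-of-rootOfOrder {p} {c = c} f∣g record { modulus = suc k ; root = ρ ; isRoot = isRoot ; hasOrder = hasOrder } =
  s , isRecurrence-of-annihilated c {s} g[s]≡0 , k , exactlyResidues-of-powers k hasOrder (Roots.recSeq≈^ (suc k) isRoot)
  where
  s : ℕ → ℤ
  s = recSeq (- p) 1ℤ ρ
  g[s]≡0 : ∀ n → act (charPoly c) s n ≡ 0ℤ
  g[s]≡0 = annihilates-multiple {quadratic p -1ℤ} {charPoly c} {s} f∣g (recSeq-annihilated p 1ℤ ρ)

non-root-of-unity⇒p≢0 : ∀ {p} → ¬ RatioIsRootOfUnity p -1ℤ → p ≢ 0ℤ
non-root-of-unity⇒p≢0 ratio≢ζ refl = ratio≢ζ (inj₂ (2 , s≤s z≤n , refl))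

7≤1+2j⇒2≤j : ∀ j → 7 ≤ suc (2 ℕ.* j) → 2 ≤ j
7≤1+2j⇒2≤j 0             (s≤s ())
7≤1+2j⇒2≤j 1             (s≤s (s≤s (s≤s ())))
7≤1+2j⇒2≤j (suc (suc j)) _ = s≤s (s≤s z≤n)

7≤2[1+2u]⇒2≤u : ∀ u → 7 ≤ 2 ℕ.* suc (2 ℕ.* u) → 2 ≤ u
7≤2[1+2u]⇒2≤u 0             (s≤s (s≤s ()))
7≤2[1+2u]⇒2≤u 1             (s≤s (s≤s (s≤s (s≤s (s≤s (s≤s ()))))))
7≤2[1+2u]⇒2≤u (suc (suc u)) _ = s≤s (s≤s z≤n)

4∣2*[2*u] : ∀ u → 4 ∣ 2 ℕ.* (2 ℕ.* u)
4∣2*[2*u] u = divides u (identity u)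
  where
  identity : ∀ u → 2 ℕ.* (2 ℕ.* u) ≡ u ℕ.* 4
  identity = ℕ-solve-∀

rootOfOrder : ∀ p → p ≢ 0ℤ → ∀ m → 7 ≤ m → ¬ 4 ∣ m → RootOfOrder (- p) m
rootOfOrder p p≢0 m 7≤m 4∤m with parity m
... | odd j = rootOfOrder-odd p p≢0 j (7≤1+2j⇒2≤j j 7≤m)
... | even t with parity t
...   | even u = contradiction (4∣2*[2*u] u) 4∤m
...   | odd u  = rootOfOrder-double {j = u} (rootOfOrder-odd p p≢0 u (7≤2[1+2u]⇒2≤u u 7≤m))

theorem1p3 : (p q : ℤ) → q ≡ -[1+ 0 ] → ¬ RatioIsRootOfUnity p q →
    (r : ℕ) (c : Vec ℤ r) → quadratic p q ∣ₚ charPoly c →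
    (m : ℕ) → 7 ≤ m → m ≢ 10 → ¬ (4 ∣ m) → m ∈𝔐 c
theorem1p3 p _ refl ratio≢ζ r c f∣g m 7≤m _ 4∤m =
  ∈𝔐-of-rootOfOrder {c = c} {{ℕ.>-nonZero (ℕₚ.≤-trans (s≤s z≤n) 7≤m)}} f∣g
    (rootOfOrder p (non-root-of-unity⇒p≢0 ratio≢ζ) m 7≤m 4∤m)
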